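{- For every integer $n \geq 3$, the Italian domination number of the Sierpi\'{n}ski graph $S(K_n,3)$ is $\gamma_I(S(K_n,3)) = 2n(n-1)$.
   Context: Sierpi\'{n}ski graph: for a graph $G$ with vertex set $V$ of order $n\ge 2$ and a positive integer $t$, $S(G,t)$ has as vertex set the set $V^t$ of words $u=u_1u_2\cdots u_t$ of length $t$ over the alphabet $V$. For $G=K_n$, two words $u,v$ are adjacent in $S(K_n,t)$ if and only if there is $i\in\{1,\dots,t\}$ such that $u_j=v_j$ for $j<i$, $u_i\neq v_i$, and $u_j=v_i$ and $v_j=u_i$ for all $j>i$. An Italian dominating function (IDF) of a graph $G$ is a function $f:V(G)\to\{0,1,2\}$ such that every vertex $v$ with $f(v)=0$ satisfies $\sum_{u\in N(v)} f(u)\ge 2$, where $N(v)$ is the open neighbourhood of $v$. The weight of $f$ is $\sum_{v\in V(G)} f(v)$, and the Italian domination number $\gamma_I(G)$ is the minimum weight of an IDF of $G$. -}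

module Defs where

open import Data.Nat using (ℕ; zero; suc; _≤_)
open import Data.Fin using (Fin; _<_; _<?_)
open import Data.Fin.Properties using (_≟_; any?; all?)
open import Data.Vec using (Vec; []; _∷_; lookup)
open import Data.List using (List; []; _∷_; map; concatMap; filter)
open import Data.Nat.ListAction using (sum)
open import Data.List.Base using (allFin)
open import Data.Product using (Σ; _×_; _,_)
open import Relation.Binary.PropositionalEquality using (_≡_; _≢_)
open import Relation.Nullary using (Dec; ¬?)
open import Relation.Nullary.Decidable using (_×-dec_; _→-dec_)

-- Words of length t over the alphabet V(K_n) = Fin n : vertices of S(K_n,t).
Word : ℕ → ℕ → Set
Word n t = Vec (Fin n) t

SAdj : ∀ {n t} → Word n t → Word n t → Set
SAdj {n} {t} u v =
  Σ (Fin t) λ i →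
    (∀ j → j < i → lookup u j ≡ lookup v j)
    × (lookup u i ≢ lookup v i)
    × (∀ j → i < j → (lookup u j ≡ lookup v i) × (lookup v j ≡ lookup u i))

SAdj? : ∀ {n t} (u v : Word n t) → Dec (SAdj u v)
SAdj? {n} {t} u v = any? λ i →
  all? (λ j → (j <? i) →-dec (lookup u j ≟ lookup v j))
  ×-dec ¬? (lookup u i ≟ lookup v i)
  ×-dec all? (λ j → (i <? j) →-dec
                    ((lookup u j ≟ lookup v i) ×-dec (lookup v j ≟ lookup u i)))

allWords : (n t : ℕ) → List (Word n t)
allWords n zero = [] ∷ []
allWords n (suc t) = concatMap (λ a → map (a ∷_) (allWords n t)) (allFin n)

nbrSum : ∀ {n t} → (Word n t → ℕ) → Word n t → ℕ
nbrSum {n} {t} f v = sum (map f (filter (λ u → SAdj? u v) (allWords n t)))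

weight : ∀ {n t} → (Word n t → ℕ) → ℕ
weight {n} {t} f = sum (map f (allWords n t))

IsIDF : (n t : ℕ) → (Word n t → ℕ) → Set
IsIDF n t f = (∀ v → f v ≤ 2) × (∀ v → f v ≡ 0 → 2 ≤ nbrSum f v)

ItalianDominationNumber : (n t k : ℕ) → Set
ItalianDominationNumber n t k =
  (Σ (Word n t → ℕ) λ f → IsIDF n t f × weight f ≡ k)
  × (∀ f → IsIDF n t f → k ≤ weight f)

-- The words pq• span cliques K_n of S(K_n,3), and besides its clique neighbours a
-- vertex pqr has at most one further neighbour outer(pqr); outer is an involution of
-- the vertex set. So if an Italian dominating function f vanishes at pqr, then
-- 2 ≤ w(pq) + f(outer(pqr)), where w(pq) is the weight of the clique pq•. In a clique
-- of weight w < 2 at least n − w vertices vanish and each needs 2 − w from outside,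
-- whence 2(n − 1) ≤ (n − 1) w(pq) + Σ_c f(outer(pqc)) for every clique; summing over
-- the n² cliques, outer being a bijection, gives 2n²(n − 1) ≤ n · weight f.
--
-- Conversely, with indices mod n ≥ 3, put 1 on x y (x − 1) in every clique xy•, and a
-- second 1 on x y (x + 1) unless y = x ± 1. Every block x•• then has weight 2(n − 1),
-- and a vertex of value 0 always has two neighbours of value 1.

module Submission where

open import Defs
open import Data.Nat using (ℕ; zero; suc; _+_; _*_; _^_; _∸_; _≤_; _<_; z≤n; s≤s)
open import Data.Nat.Properties
  using (+-assoc; +-comm; +-identityʳ; +-cancelʳ-≡; +-mono-≤; +-monoʳ-≤;
         *-identityˡ; *-identityʳ; *-zeroʳ; *-assoc; *-comm; *-mono-≤; *-monoʳ-≤; *-cancelʳ-≤;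
         ≤-refl; ≤-reflexive; ≤-trans; m≤m+n; m≤n+m; m≤m*n; m∸n≤m; m≤n+o⇒m∸n≤o;
         1+n≢n; m≢1+n+m; n>0⇒n≢0; +-*-semiring; module ≤-Reasoning)
open import Data.Fin using (Fin; zero; suc; punchIn; toℕ; fromℕ; inject₁)
open import Data.Fin.Properties using (_≟_; punchInᵢ≢i; toℕ-inject₁)
open import Data.Vec using ([]; _∷_; _∷ʳ_; head; tail; lookup; reverse)
open import Data.Vec.Properties using (≡-dec; ∷-injectiveˡ; ∷-injectiveʳ)
open import Data.List using (List; []; _∷_; map; concat; concatMap; filter; tabulate; allFin)
open import Data.List.Properties using (map-tabulate; map-concatMap; map-∘)
open import Data.Nat.ListAction using (sum)
open import Data.Nat.ListAction.Properties using (sum-++)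
open import Algebra.Properties.Semiring.Sum +-*-semiring
  using (sum-syntax; sum-cong-≗; sum-remove; ∑-distrib-+; ∑-comm; *-distribˡ-sum)
open import Relation.Binary.PropositionalEquality
open import Data.Product using (_×_; _,_)
open import Data.Sum using (_⊎_; inj₁; inj₂)
open import Data.Nat.Tactic.RingSolver using (solve-∀)
open import Relation.Nullary using (Dec; yes; no; does; ¬?; contradiction)
open import Relation.Nullary.Decidable using (_×-dec_)
open import Data.Bool using (true; false; if_then_else_)
open import Function using (_∘_; id)

𝟙 : ∀ {p} {P : Set p} → Dec P → ℕ
𝟙 P? = if does P? then 1 else 0

𝟙-yes : ∀ {p} {P : Set p} (P? : Dec P) → P → 𝟙 P? ≡ 1
𝟙-yes (yes _) _ = refl
𝟙-yes (no ¬p) p = contradiction p ¬p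

𝟙≤1 : ∀ {p} {P : Set p} (P? : Dec P) → 𝟙 P? ≤ 1
𝟙≤1 (yes _) = ≤-refl
𝟙≤1 (no _)  = z≤n

𝟙*-≤ : ∀ {p} {P : Set p} (P? : Dec P) {x y} → (P → x ≤ y) → 𝟙 P? * x ≤ y
𝟙*-≤ (yes p) {x} x≤y = ≤-trans (≤-reflexive (+-identityʳ x)) (x≤y p)
𝟙*-≤ (no _)      _   = z≤n

∑-mono-≤ : ∀ {n} {f g : Fin n → ℕ} → (∀ i → f i ≤ g i) → ∑[ i < n ] f i ≤ ∑[ i < n ] g i
∑-mono-≤ {zero}  f≤g = z≤n
∑-mono-≤ {suc n} f≤g = +-mono-≤ (f≤g zero) (∑-mono-≤ (f≤g ∘ suc))

∑-const : ∀ n x → ∑[ i < n ] x ≡ n * x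
∑-const zero    x = refl
∑-const (suc n) x = cong (x +_) (∑-const n x)

∑-δ : ∀ {n} (f : Fin n → ℕ) j → ∑[ i < n ] (𝟙 (i ≟ j) * f i) ≡ f j
∑-δ {suc n} f zero    = begin
  f zero + 0 + ∑[ i < n ] 0  ≡⟨ cong₂ _+_ (+-identityʳ (f zero)) (∑-const n 0) ⟩
  f zero + n * 0             ≡⟨ cong (f zero +_) (*-zeroʳ n) ⟩
  f zero + 0                 ≡⟨ +-identityʳ (f zero) ⟩
  f zero                     ∎
  where open ≡-Reasoning
∑-δ {suc n} f (suc j) = ∑-δ (f ∘ suc) j

∑-𝟙-≟ : ∀ {n} (j : Fin n) → ∑[ i < n ] 𝟙 (i ≟ j) ≡ 1
∑-𝟙-≟ {n} j = trans (sum-cong-≗ {n} (λ i → sym (*-identityʳ (𝟙 (i ≟ j))))) (∑-δ (λ _ → 1) j)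

∑-update : ∀ {n} (f g : Fin n → ℕ) j → (∀ i → i ≢ j → f i ≡ g i) →
           ∑[ i < n ] f i + g j ≡ ∑[ i < n ] g i + f j
∑-update {suc n} f g j f≡g = begin
  ∑[ i < suc n ] f i + g j  ≡⟨ cong (_+ g j) (sum-remove {i = j} f) ⟩
  f j + R f + g j           ≡⟨ cong (λ r → f j + r + g j) (sum-cong-≗ (λ i → f≡g _ (punchInᵢ≢i j i))) ⟩
  f j + R g + g j           ≡⟨ +-comm (f j + R g) (g j) ⟩
  g j + (f j + R g)         ≡⟨ cong (g j +_) (+-comm (f j) (R g)) ⟩
  g j + (R g + f j)         ≡⟨ +-assoc (g j) (R g) (f j) ⟨
  g j + R g + f j           ≡⟨ cong (_+ f j) (sum-remove {i = j} g) ⟨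
  ∑[ i < suc n ] g i + f j  ∎
  where
  open ≡-Reasoning
  R : (Fin (suc n) → ℕ) → ℕ
  R h = ∑[ i < n ] h (punchIn j i)

sum-concat : (xss : List (List ℕ)) → sum (concat xss) ≡ sum (map sum xss)
sum-concat []         = refl
sum-concat (xs ∷ xss) = trans (sum-++ xs (concat xss)) (cong (sum xs +_) (sum-concat xss))

sum-tabulate : ∀ {n} (f : Fin n → ℕ) → sum (tabulate f) ≡ ∑[ i < n ] f i
sum-tabulate {zero}  f = refl
sum-tabulate {suc n} f = cong (f zero +_) (sum-tabulate (f ∘ suc))

sum-map-filter : ∀ {a p} {A : Set a} {P : A → Set p} (P? : ∀ x → Dec (P x)) (f : A → ℕ) xs →
                 sum (map f (filter P? xs)) ≡ sum (map (λ x → 𝟙 (P? x) * f x) xs)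
sum-map-filter P? f []       = refl
sum-map-filter P? f (x ∷ xs) with does (P? x)
... | true  = cong₂ _+_ (sym (+-identityʳ (f x))) (sum-map-filter P? f xs)
... | false = sum-map-filter P? f xs

∑ʷ : ∀ {n t} → (Word n t → ℕ) → ℕ
∑ʷ {t = zero}      g = g []
∑ʷ {n} {t = suc t} g = ∑[ a < n ] ∑ʷ (λ w → g (a ∷ w))

sum-allWords : ∀ {n t} (g : Word n t → ℕ) → sum (map g (allWords n t)) ≡ ∑ʷ g
sum-allWords {n} {zero}  g = +-identityʳ (g [])
sum-allWords {n} {suc t} g = begin
  sum (map g (concatMap prefixed (allFin n)))            ≡⟨ cong sum (map-concatMap g prefixed (allFin n)) ⟩
  sum (concat (map (map g ∘ prefixed) (allFin n)))       ≡⟨ sum-concat (map (map g ∘ prefixed) (allFin n)) ⟩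
  sum (map sum (map (map g ∘ prefixed) (allFin n)))      ≡⟨ cong sum (map-∘ (allFin n)) ⟨
  sum (map (sum ∘ map g ∘ prefixed) (allFin n))          ≡⟨ cong sum (map-tabulate id (sum ∘ map g ∘ prefixed)) ⟩
  sum (tabulate (sum ∘ map g ∘ prefixed))                ≡⟨ sum-tabulate (sum ∘ map g ∘ prefixed) ⟩
  ∑[ a < n ] sum (map g (prefixed a))                    ≡⟨ sum-cong-≗ {n} (λ a → cong sum (map-∘ (allWords n t))) ⟨
  ∑[ a < n ] sum (map (λ w → g (a ∷ w)) (allWords n t)) ≡⟨ sum-cong-≗ {n} (λ a → sum-allWords (λ w → g (a ∷ w))) ⟩
  ∑ʷ g                                               ∎
  where
  open ≡-Reasoning
  prefixed : Fin n → List (Word n (suc t))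
  prefixed a = map (a ∷_) (allWords n t)

nbrSum-∑ʷ : ∀ {n t} (f : Word n t → ℕ) v → nbrSum f v ≡ ∑ʷ (λ u → 𝟙 (SAdj? u v) * f u)
nbrSum-∑ʷ {n} {t} f v = trans (sum-map-filter (λ u → SAdj? u v) f (allWords n t)) (sum-allWords (λ u → 𝟙 (SAdj? u v) * f u))

module _ {n : ℕ} where

  ∑ʷ-cong : ∀ {t} {g h : Word n t → ℕ} → (∀ w → g w ≡ h w) → ∑ʷ g ≡ ∑ʷ h
  ∑ʷ-cong {zero}  g≡h = g≡h []
  ∑ʷ-cong {suc t} g≡h = sum-cong-≗ {n} (λ a → ∑ʷ-cong (λ w → g≡h (a ∷ w)))

  ∑ʷ-mono-≤ : ∀ {t} {g h : Word n t → ℕ} → (∀ w → g w ≤ h w) → ∑ʷ g ≤ ∑ʷ h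
  ∑ʷ-mono-≤ {zero}  g≤h = g≤h []
  ∑ʷ-mono-≤ {suc t} g≤h = ∑-mono-≤ (λ a → ∑ʷ-mono-≤ (λ w → g≤h (a ∷ w)))

  ∑ʷ-distrib-+ : ∀ {t} (g h : Word n t → ℕ) → ∑ʷ (λ w → g w + h w) ≡ ∑ʷ g + ∑ʷ h
  ∑ʷ-distrib-+ {zero}  g h = refl
  ∑ʷ-distrib-+ {suc t} g h =
    trans (sum-cong-≗ {n} (λ a → ∑ʷ-distrib-+ (λ w → g (a ∷ w)) (λ w → h (a ∷ w))))
          (∑-distrib-+ (λ a → ∑ʷ (λ w → g (a ∷ w))) (λ a → ∑ʷ (λ w → h (a ∷ w))))

  *-distribˡ-∑ʷ : ∀ {t} x (g : Word n t → ℕ) → x * ∑ʷ g ≡ ∑ʷ (λ w → x * g w)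
  *-distribˡ-∑ʷ {zero}  x g = refl
  *-distribˡ-∑ʷ {suc t} x g =
    trans (*-distribˡ-sum x (λ a → ∑ʷ (λ w → g (a ∷ w))))
          (sum-cong-≗ {n} (λ a → *-distribˡ-∑ʷ x (λ w → g (a ∷ w))))

  ∑ʷ-const : ∀ t x → ∑ʷ {n} {t} (λ _ → x) ≡ n ^ t * x
  ∑ʷ-const zero    x = sym (+-identityʳ x)
  ∑ʷ-const (suc t) x = begin
    ∑[ a < n ] ∑ʷ {n} {t} (λ _ → x)  ≡⟨ sum-cong-≗ {n} (λ _ → ∑ʷ-const t x) ⟩
    ∑[ a < n ] (n ^ t * x)           ≡⟨ ∑-const n (n ^ t * x) ⟩
    n * (n ^ t * x)                  ≡⟨ *-assoc n (n ^ t) x ⟨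
    n ^ suc t * x                    ∎
    where open ≡-Reasoning

  ∑ʷ-δ-head : ∀ {t} (g : Word n (suc t) → ℕ) a →
              ∑ʷ (λ w → 𝟙 (head w ≟ a) * g w) ≡ ∑ʷ (λ w → g (a ∷ w))
  ∑ʷ-δ-head g a =
    trans (sum-cong-≗ {n} (λ b → sym (*-distribˡ-∑ʷ (𝟙 (b ≟ a)) (λ w → g (b ∷ w)))))
          (∑-δ (λ b → ∑ʷ (λ w → g (b ∷ w))) a)

δʷ : ∀ {n t} → Word n t → Word n t → ℕ
δʷ []      []      = 1
δʷ (a ∷ u) (b ∷ w) = 𝟙 (a ≟ b) * δʷ u w

δʷ-refl : ∀ {n t} (w : Word n t) → δʷ w w ≡ 1
δʷ-refl []      = refl
δʷ-refl (a ∷ w) = cong₂ _*_ (𝟙-yes (a ≟ a) refl) (δʷ-refl w)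

δʷ-≢ : ∀ {n t} {u w : Word n t} → u ≢ w → δʷ u w ≡ 0
δʷ-≢ {u = []}    {[]}    u≢w = contradiction refl u≢w
δʷ-≢ {u = a ∷ u} {b ∷ w} u≢w with a ≟ b
... | yes refl = trans (+-identityʳ (δʷ u w)) (δʷ-≢ (u≢w ∘ cong (a ∷_)))
... | no _     = refl

∑ʷ-δʷ : ∀ {n t} (g : Word n t → ℕ) w → ∑ʷ (λ u → δʷ u w * g u) ≡ g w
∑ʷ-δʷ g []      = *-identityˡ (g [])
∑ʷ-δʷ g (a ∷ w) = begin
  ∑ʷ (λ u → 𝟙 (head u ≟ a) * δʷ (tail u) w * g u)   ≡⟨ ∑ʷ-cong (λ u → *-assoc (𝟙 (head u ≟ a)) (δʷ (tail u) w) (g u)) ⟩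
  ∑ʷ (λ u → 𝟙 (head u ≟ a) * (δʷ (tail u) w * g u)) ≡⟨ ∑ʷ-δ-head (λ u → δʷ (tail u) w * g u) a ⟩
  ∑ʷ (λ u → δʷ u w * g (a ∷ u))                     ≡⟨ ∑ʷ-δʷ (g ∘ (a ∷_)) w ⟩
  g (a ∷ w)                                         ∎
  where open ≡-Reasoning

∑ʷ-pair-≤ : ∀ {n t} (g : Word n t → ℕ) {u w} → u ≢ w → g u + g w ≤ ∑ʷ g
∑ʷ-pair-≤ g {u} {w} u≢w = begin
  g u + g w                                      ≡⟨ cong₂ _+_ (∑ʷ-δʷ g u) (∑ʷ-δʷ g w) ⟨
  ∑ʷ (λ v → δʷ v u * g v) + ∑ʷ (λ v → δʷ v w * g v) ≡⟨ ∑ʷ-distrib-+ (λ v → δʷ v u * g v) (λ v → δʷ v w * g v) ⟨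
  ∑ʷ (λ v → δʷ v u * g v + δʷ v w * g v)         ≤⟨ ∑ʷ-mono-≤ at-most-one-hit ⟩
  ∑ʷ g                                           ∎
  where
  open ≤-Reasoning
  at-most-one-hit : ∀ v → δʷ v u * g v + δʷ v w * g v ≤ g v
  at-most-one-hit v with ≡-dec _≟_ v u | ≡-dec _≟_ v w
  ... | yes refl | _        rewrite δʷ-refl v | δʷ-≢ u≢w =
    ≤-reflexive (trans (+-identityʳ _) (+-identityʳ (g v)))
  ... | no v≢u   | yes refl rewrite δʷ-≢ v≢u | δʷ-refl v = ≤-reflexive (+-identityʳ (g v))
  ... | no v≢u   | no v≢w   rewrite δʷ-≢ v≢u | δʷ-≢ v≢w = z≤n

two-neighbours⇒2≤nbrSum : ∀ {n t} (f : Word n t → ℕ) v {u₁ u₂} → u₁ ≢ u₂ →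
                           SAdj u₁ v → SAdj u₂ v → 1 ≤ f u₁ → 1 ≤ f u₂ → 2 ≤ nbrSum f v
two-neighbours⇒2≤nbrSum {n} {t} f v {u₁} {u₂} u₁≢u₂ adj₁ adj₂ 1≤fu₁ 1≤fu₂ = begin
  2                       ≤⟨ +-mono-≤ (≤-trans 1≤fu₁ (hit u₁ adj₁)) (≤-trans 1≤fu₂ (hit u₂ adj₂)) ⟩
  nbrTerm u₁ + nbrTerm u₂ ≤⟨ ∑ʷ-pair-≤ nbrTerm u₁≢u₂ ⟩
  ∑ʷ nbrTerm              ≡⟨ nbrSum-∑ʷ f v ⟨
  nbrSum f v              ∎
  where
  open ≤-Reasoning
  nbrTerm : Word n t → ℕ
  nbrTerm u = 𝟙 (SAdj? u v) * f u
  hit : ∀ u → SAdj u v → f u ≤ nbrTerm u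
  hit u adj rewrite 𝟙-yes (SAdj? u v) adj = ≤-reflexive (sym (*-identityˡ (f u)))

module _ {n : ℕ} where

  cliqueWeight : (Word n 3 → ℕ) → Word n 2 → ℕ
  cliqueWeight f w = ∑[ c < n ] f (w ∷ʳ c)

  -- The neighbour of pqr outside the clique pq•, or pqr itself when p = q = r.
  outer : Word n 3 → Word n 3
  outer (p ∷ q ∷ r ∷ []) with q ≟ r
  ... | yes _ = q ∷ p ∷ p ∷ []
  ... | no _  = p ∷ r ∷ q ∷ []

  outer-diag : ∀ (p q : Fin n) → outer (p ∷ q ∷ q ∷ []) ≡ q ∷ p ∷ p ∷ []
  outer-diag p q with q ≟ q
  ... | yes _   = refl
  ... | no q≢q  = contradiction refl q≢q

  outer-offdiag : ∀ (p : Fin n) {q r} → q ≢ r → outer (p ∷ q ∷ r ∷ []) ≡ p ∷ r ∷ q ∷ []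
  outer-offdiag p {q} {r} q≢r with q ≟ r
  ... | yes q≡r = contradiction q≡r q≢r
  ... | no _    = refl

  SAdj-clique : ∀ (a b : Fin n) {c d} → c ≢ d → SAdj (a ∷ b ∷ c ∷ []) (a ∷ b ∷ d ∷ [])
  SAdj-clique a b {c} {d} c≢d = suc (suc zero) , agree , c≢d , after
    where
    agree : ∀ (j : Fin 3) → toℕ j < 2 → lookup (a ∷ b ∷ c ∷ []) j ≡ lookup (a ∷ b ∷ d ∷ []) j
    agree zero       _ = refl
    agree (suc zero) _ = refl
    agree (suc (suc zero)) (s≤s (s≤s ()))
    after : ∀ (j : Fin 3) → 2 < toℕ j →
            (lookup (a ∷ b ∷ c ∷ []) j ≡ d) × (lookup (a ∷ b ∷ d ∷ []) j ≡ c)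
    after zero ()
    after (suc zero) (s≤s ())
    after (suc (suc zero)) (s≤s (s≤s ()))

  SAdj-swap₁ : ∀ (a : Fin n) {b c} → c ≢ b → SAdj (a ∷ c ∷ b ∷ []) (a ∷ b ∷ c ∷ [])
  SAdj-swap₁ a {b} {c} c≢b = suc zero , agree , c≢b , after
    where
    agree : ∀ (j : Fin 3) → toℕ j < 1 → lookup (a ∷ c ∷ b ∷ []) j ≡ lookup (a ∷ b ∷ c ∷ []) j
    agree zero       _ = refl
    agree (suc zero) (s≤s ())
    agree (suc (suc zero)) (s≤s ())
    after : ∀ (j : Fin 3) → 1 < toℕ j → (lookup (a ∷ c ∷ b ∷ []) j ≡ b) × (lookup (a ∷ b ∷ c ∷ []) j ≡ c)
    after zero ()
    after (suc zero) (s≤s ())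
    after (suc (suc zero)) _ = refl , refl

  SAdj-swap₀ : ∀ {a b : Fin n} → b ≢ a → SAdj (b ∷ a ∷ a ∷ []) (a ∷ b ∷ b ∷ [])
  SAdj-swap₀ {a} {b} b≢a = zero , agree , b≢a , after
    where
    agree : ∀ (j : Fin 3) → toℕ j < 0 → lookup (b ∷ a ∷ a ∷ []) j ≡ lookup (a ∷ b ∷ b ∷ []) j
    agree zero ()
    agree (suc zero) ()
    agree (suc (suc zero)) ()
    after : ∀ (j : Fin 3) → 0 < toℕ j → (lookup (b ∷ a ∷ a ∷ []) j ≡ a) × (lookup (a ∷ b ∷ b ∷ []) j ≡ b)
    after zero ()
    after (suc zero) _ = refl , refl
    after (suc (suc zero)) _ = refl , refl

  SAdj-clique-or-outer : ∀ {a b c p q r : Fin n} → SAdj (a ∷ b ∷ c ∷ []) (p ∷ q ∷ r ∷ []) →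
                         (a ≡ p × b ≡ q) ⊎ (a ∷ b ∷ c ∷ [] ≡ outer (p ∷ q ∷ r ∷ []))
  SAdj-clique-or-outer {a} {p = p} (zero , _ , a≢p , after)
    with refl , refl ← after (suc zero) (s≤s z≤n)
       | refl , refl ← after (suc (suc zero)) (s≤s z≤n) = inj₂ (sym (outer-diag p a))
  SAdj-clique-or-outer {p = p} (suc zero , agree , b≢q , after)
    with refl ← agree zero (s≤s z≤n)
       | refl , refl ← after (suc (suc zero)) (s≤s (s≤s z≤n)) = inj₂ (sym (outer-offdiag p (b≢q ∘ sym)))
  SAdj-clique-or-outer (suc (suc zero) , agree , _) =
    inj₁ (agree zero (s≤s z≤n) , agree (suc zero) (s≤s (s≤s z≤n)))

  nbrSum-≤-clique+outer : ∀ (f : Word n 3 → ℕ) p q r →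
    nbrSum f (p ∷ q ∷ r ∷ []) ≤ cliqueWeight f (p ∷ q ∷ []) + f (outer (p ∷ q ∷ r ∷ []))
  nbrSum-≤-clique+outer f p q r = begin
    nbrSum f v                                       ≡⟨ nbrSum-∑ʷ f v ⟩
    ∑ʷ (λ u → 𝟙 (SAdj? u v) * f u)                   ≤⟨ ∑ʷ-mono-≤ pointwise ⟩
    ∑ʷ (λ u → inClique u + δʷ u (outer v) * f u)     ≡⟨ ∑ʷ-distrib-+ inClique (λ u → δʷ u (outer v) * f u) ⟩
    ∑ʷ inClique + ∑ʷ (λ u → δʷ u (outer v) * f u)    ≡⟨ cong₂ _+_ clique-sum (∑ʷ-δʷ f (outer v)) ⟩
    cliqueWeight f (p ∷ q ∷ []) + f (outer v)                   ∎
    where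
    open ≤-Reasoning
    v : Word n 3
    v = p ∷ q ∷ r ∷ []
    inClique : Word n 3 → ℕ
    inClique u = 𝟙 (head u ≟ p) * (𝟙 (head (tail u) ≟ q) * f u)
    clique-sum : ∑ʷ inClique ≡ cliqueWeight f (p ∷ q ∷ [])
    clique-sum = trans (∑ʷ-δ-head (λ u → 𝟙 (head (tail u) ≟ q) * f u) p) (∑ʷ-δ-head (λ w → f (p ∷ w)) q)
    pointwise : ∀ u → 𝟙 (SAdj? u v) * f u ≤ inClique u + δʷ u (outer v) * f u
    pointwise u@(a ∷ b ∷ c ∷ []) = 𝟙*-≤ (SAdj? u v) (by-case ∘ SAdj-clique-or-outer)
      where
      by-case : (a ≡ p × b ≡ q) ⊎ (u ≡ outer v) → f u ≤ inClique u + δʷ u (outer v) * f u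
      by-case (inj₁ (refl , refl)) rewrite 𝟙-yes (p ≟ p) refl | 𝟙-yes (q ≟ q) refl =
        ≤-trans (≤-reflexive (sym (trans (*-identityˡ _) (*-identityˡ (f u))))) (m≤m+n _ _)
      by-case (inj₂ u≡outer) rewrite sym u≡outer | δʷ-refl u =
        ≤-trans (≤-reflexive (sym (*-identityˡ (f u)))) (m≤n+m _ (inClique u))

  -- On the clique ab•, outer is abc ↦ acb except at abb ↦ baa.
  ∑ʷ-outer : ∀ (f : Word n 3 → ℕ) → ∑ʷ (f ∘ outer) ≡ ∑ʷ f
  ∑ʷ-outer f = +-cancelʳ-≡ (∑ʷ diag) (∑ʷ (f ∘ outer)) (∑ʷ f) (begin
    ∑ʷ (f ∘ outer) + ∑ʷ diag                          ≡⟨ ∑ʷ-distrib-+ (cliqueWeight (f ∘ outer)) diag ⟨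
    ∑ʷ (λ w → cliqueWeight (f ∘ outer) w + diag w)      ≡⟨ ∑ʷ-cong exchange ⟩
    ∑ʷ (λ w → transposed w + diag (reverse w))        ≡⟨ ∑ʷ-distrib-+ transposed (diag ∘ reverse) ⟩
    ∑ʷ transposed + ∑ʷ (diag ∘ reverse)               ≡⟨ cong₂ _+_ (sum-cong-≗ {n} (λ a → ∑-comm (λ b c → f (a ∷ c ∷ b ∷ []))))
                                                                     (∑-comm (λ b a → diag (a ∷ b ∷ []))) ⟩
    ∑ʷ f + ∑ʷ diag                                    ∎)
    where
    open ≡-Reasoning
    diag transposed : Word n 2 → ℕ
    diag (a ∷ b ∷ [])       = f (a ∷ b ∷ b ∷ [])
    transposed (a ∷ b ∷ []) = ∑[ c < n ] f (a ∷ c ∷ b ∷ [])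
    exchange : ∀ w → cliqueWeight (f ∘ outer) w + diag w ≡ transposed w + diag (reverse w)
    exchange (a ∷ b ∷ []) =
      trans (∑-update (λ c → f (outer (a ∷ b ∷ c ∷ []))) (λ c → f (a ∷ c ∷ b ∷ [])) b
                      (λ c c≢b → cong f (outer-offdiag a (c≢b ∘ sym))))
            (cong (transposed (a ∷ b ∷ []) +_) (cong f (outer-diag a b)))

deficit⇒bound : ∀ n w h → n * (2 ∸ w) ≤ h + (2 ∸ w) * w → 2 * (n ∸ 1) ≤ (n ∸ 1) * w + h
deficit⇒bound n zero h n*2≤h = begin
  2 * (n ∸ 1)    ≤⟨ *-monoʳ-≤ 2 (m∸n≤m n 1) ⟩
  2 * n          ≡⟨ *-comm 2 n ⟩
  n * 2          ≤⟨ n*2≤h ⟩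
  h + 0          ≡⟨ +-comm h 0 ⟩
  0 + h          ≡⟨ cong (_+ h) (*-zeroʳ (n ∸ 1)) ⟨
  (n ∸ 1) * 0 + h ∎
  where open ≤-Reasoning
deficit⇒bound n (suc zero) h n*1≤h+1 = begin
  2 * (n ∸ 1)         ≡⟨ cong ((n ∸ 1) +_) (+-identityʳ (n ∸ 1)) ⟩
  (n ∸ 1) + (n ∸ 1)   ≤⟨ +-monoʳ-≤ (n ∸ 1) (m≤n+o⇒m∸n≤o n 1 n≤1+h) ⟩
  (n ∸ 1) + h         ≡⟨ cong (_+ h) (*-identityʳ (n ∸ 1)) ⟨
  (n ∸ 1) * 1 + h     ∎
  where
  open ≤-Reasoning
  n≤1+h : n ≤ 1 + h
  n≤1+h = subst₂ _≤_ (*-identityʳ n) (+-comm h 1) n*1≤h+1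
deficit⇒bound n (suc (suc w)) h _ = begin
  2 * (n ∸ 1)              ≡⟨ *-comm 2 (n ∸ 1) ⟩
  (n ∸ 1) * 2              ≤⟨ *-monoʳ-≤ (n ∸ 1) (s≤s (s≤s z≤n)) ⟩
  (n ∸ 1) * suc (suc w)    ≤⟨ m≤m+n _ h ⟩
  (n ∸ 1) * suc (suc w) + h ∎
  where open ≤-Reasoning

module _ {n : ℕ} (f : Word n 3 → ℕ) (dominated : ∀ v → f v ≡ 0 → 2 ≤ nbrSum f v) where

  -- A zero of f in a clique of weight w needs 2 ∸ w from its outer neighbour.
  clique-bound : ∀ w → 2 * (n ∸ 1) ≤ (n ∸ 1) * cliqueWeight f w + cliqueWeight (f ∘ outer) w
  clique-bound w@(a ∷ b ∷ []) = deficit⇒bound n cw (cliqueWeight (f ∘ outer) w) (begin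
    n * (2 ∸ cw)                                      ≡⟨ ∑-const n (2 ∸ cw) ⟨
    ∑[ c < n ] (2 ∸ cw)                               ≤⟨ ∑-mono-≤ per-vertex ⟩
    ∑[ c < n ] (f (outer (w ∷ʳ c)) + (2 ∸ cw) * f (w ∷ʳ c))
      ≡⟨ ∑-distrib-+ (λ c → f (outer (w ∷ʳ c))) (λ c → (2 ∸ cw) * f (w ∷ʳ c)) ⟩
    cliqueWeight (f ∘ outer) w + ∑[ c < n ] ((2 ∸ cw) * f (w ∷ʳ c))
      ≡⟨ cong (cliqueWeight (f ∘ outer) w +_) (*-distribˡ-sum (2 ∸ cw) (λ c → f (w ∷ʳ c))) ⟨
    cliqueWeight (f ∘ outer) w + (2 ∸ cw) * cw          ∎)
    where
    open ≤-Reasoning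
    cw : ℕ
    cw = cliqueWeight f w
    per-vertex : ∀ c → 2 ∸ cw ≤ f (outer (w ∷ʳ c)) + (2 ∸ cw) * f (w ∷ʳ c)
    per-vertex c with f (a ∷ b ∷ c ∷ []) in fv≡
    ... | zero  = ≤-trans (m≤n+o⇒m∸n≤o 2 cw (≤-trans (dominated _ fv≡) (nbrSum-≤-clique+outer f a b c)))
                          (m≤m+n _ _)
    ... | suc k = ≤-trans (m≤m*n (2 ∸ cw) (suc k)) (m≤n+m _ _)

italian-lower-bound : ∀ n (f : Word n 3 → ℕ) → (∀ v → f v ≡ 0 → 2 ≤ nbrSum f v) →
                      2 * n * (n ∸ 1) ≤ weight f
italian-lower-bound zero      f _         = z≤n
italian-lower-bound n@(suc m) f dominated = *-cancelʳ-≤ (2 * n * m) (weight f) n (begin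
  2 * n * m * n                                             ≡⟨ count m ⟩
  n ^ 2 * (2 * m)                                           ≡⟨ ∑ʷ-const {n} 2 (2 * m) ⟨
  ∑ʷ {n} {2} (λ _ → 2 * m)                                  ≤⟨ ∑ʷ-mono-≤ (clique-bound f dominated) ⟩
  ∑ʷ (λ w → m * cliqueWeight f w + cliqueWeight (f ∘ outer) w)
    ≡⟨ ∑ʷ-distrib-+ (λ w → m * cliqueWeight f w) (cliqueWeight (f ∘ outer)) ⟩
  ∑ʷ (λ w → m * cliqueWeight f w) + ∑ʷ (f ∘ outer)            ≡⟨ cong₂ _+_ (sym (*-distribˡ-∑ʷ m (cliqueWeight f))) (∑ʷ-outer f) ⟩
  m * ∑ʷ f + ∑ʷ f                                           ≡⟨ +-comm (m * ∑ʷ f) (∑ʷ f) ⟩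
  n * ∑ʷ f                                                  ≡⟨ *-comm n (∑ʷ f) ⟩
  ∑ʷ f * n                                                  ≡⟨ cong (_* n) (sum-allWords f) ⟨
  weight f * n                                              ∎)
  where
  open ≤-Reasoning
  count : ∀ k → 2 * (1 + k) * k * (1 + k) ≡ (1 + k) * ((1 + k) * 1) * (2 * k)
  count = solve-∀

predMod : ∀ {m} → Fin (suc m) → Fin (suc m)
predMod {m} zero    = fromℕ m
predMod     (suc i) = inject₁ i

sucMod : ∀ {m} → Fin (suc m) → Fin (suc m)
sucMod {zero}  zero    = zero
sucMod {suc m} zero    = suc zero
sucMod {suc m} (suc i) with sucMod i
... | zero  = zero
... | suc j = suc (suc j)

predMod-sucMod : ∀ {m} (i : Fin (suc m)) → predMod (sucMod i) ≡ i
predMod-sucMod {zero}        zero    = refl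
predMod-sucMod {suc m}       zero    = refl
predMod-sucMod {suc zero}    (suc zero) = refl
predMod-sucMod {suc (suc m)} (suc i) with sucMod i | predMod-sucMod i
... | zero  | eq = cong suc eq
... | suc j | eq = cong suc eq

predMod-≢ : ∀ {m} (i : Fin (suc (suc m))) → predMod i ≢ i
predMod-≢ zero    ()
predMod-≢ (suc i) eq = 1+n≢n (sym (trans (sym (toℕ-inject₁ i)) (cong toℕ eq)))

predMod²-≢ : ∀ {m} (i : Fin (suc (suc (suc m)))) → predMod (predMod i) ≢ i
predMod²-≢ zero             ()
predMod²-≢ (suc zero)       ()
predMod²-≢ (suc (suc i)) eq =
  m≢1+n+m (toℕ i) {1} (trans (sym (trans (toℕ-inject₁ (inject₁ i)) (toℕ-inject₁ i))) (cong toℕ eq))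

sucMod-≢ : ∀ {m} (i : Fin (suc (suc m))) → sucMod i ≢ i
sucMod-≢ i eq = predMod-≢ i (trans (cong predMod (sym eq)) (predMod-sucMod i))

sucMod-≢-predMod : ∀ {m} (i : Fin (suc (suc (suc m)))) → sucMod i ≢ predMod i
sucMod-≢-predMod i eq = predMod²-≢ i (trans (cong predMod (sym eq)) (predMod-sucMod i))

module CyclicIDF (k : ℕ) where

  n : ℕ
  n = 3 + k

  nonShift? : (x y : Fin n) → Dec (y ≢ sucMod x × y ≢ predMod x)
  nonShift? x y = ¬? (y ≟ sucMod x) ×-dec ¬? (y ≟ predMod x)

  f : Word n 3 → ℕ
  f (x ∷ y ∷ z ∷ []) = 𝟙 (z ≟ predMod x) + 𝟙 (nonShift? x y) * 𝟙 (z ≟ sucMod x)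

  f≤2 : ∀ v → f v ≤ 2
  f≤2 (x ∷ y ∷ z ∷ []) = +-mono-≤ (𝟙≤1 (z ≟ predMod x)) (*-mono-≤ (𝟙≤1 (nonShift? x y)) (𝟙≤1 (z ≟ sucMod x)))

  f-predMod : ∀ x y → 1 ≤ f (x ∷ y ∷ predMod x ∷ [])
  f-predMod x y rewrite 𝟙-yes (predMod x ≟ predMod x) refl = s≤s z≤n

  f-sucMod : ∀ x y → y ≢ sucMod x → y ≢ predMod x → 1 ≤ f (x ∷ y ∷ sucMod x ∷ [])
  f-sucMod x y y≢s y≢p rewrite 𝟙-yes (nonShift? x y) (y≢s , y≢p) | 𝟙-yes (sucMod x ≟ sucMod x) refl =
    m≤n+m 1 _

  f≡0⇒ : ∀ x y z → f (x ∷ y ∷ z ∷ []) ≡ 0 → z ≢ predMod x × (y ≢ sucMod x → y ≢ predMod x → z ≢ sucMod x)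
  f≡0⇒ x y z f≡0 = z≢p , z≢s
    where
    z≢p : z ≢ predMod x
    z≢p refl = n>0⇒n≢0 (f-predMod x y) f≡0
    z≢s : y ≢ sucMod x → y ≢ predMod x → z ≢ sucMod x
    z≢s y≢s y≢p refl = n>0⇒n≢0 (f-sucMod x y y≢s y≢p) f≡0

  f-dominating : ∀ v → f v ≡ 0 → 2 ≤ nbrSum f v
  f-dominating (x ∷ y ∷ z ∷ []) f≡0 with f≡0⇒ x y z f≡0 | y ≟ sucMod x | y ≟ predMod x
  ... | z≢p , _ | yes refl | _ with z ≟ sucMod x
  ...   | yes refl = two-neighbours⇒2≤nbrSum f (x ∷ sucMod x ∷ sucMod x ∷ []) (sucMod-≢ x ∘ sym ∘ ∷-injectiveˡ)
                       (SAdj-clique x (sucMod x) (sucMod-≢-predMod x ∘ sym)) (SAdj-swap₀ (sucMod-≢ x))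
                       (f-predMod x (sucMod x)) (subst (λ w → 1 ≤ f (sucMod x ∷ x ∷ w ∷ [])) (predMod-sucMod x)
                                                      (f-predMod (sucMod x) x))
  ...   | no z≢s   = two-neighbours⇒2≤nbrSum f (x ∷ sucMod x ∷ z ∷ []) (z≢s ∘ sym ∘ ∷-injectiveˡ ∘ ∷-injectiveʳ)
                       (SAdj-clique x (sucMod x) (z≢p ∘ sym)) (SAdj-swap₁ x z≢s)
                       (f-predMod x (sucMod x)) (f-sucMod x z z≢s z≢p)
  f-dominating (x ∷ y ∷ z ∷ []) f≡0 | z≢p , _ | no _ | yes refl =
    two-neighbours⇒2≤nbrSum f (x ∷ predMod x ∷ z ∷ []) (z≢p ∘ sym ∘ ∷-injectiveˡ ∘ ∷-injectiveʳ)
      (SAdj-clique x (predMod x) (z≢p ∘ sym)) (SAdj-swap₁ x z≢p)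
      (f-predMod x (predMod x)) (f-predMod x z)
  f-dominating (x ∷ y ∷ z ∷ []) f≡0 | z≢p , z≢s′ | no y≢s | no y≢p =
    two-neighbours⇒2≤nbrSum f (x ∷ y ∷ z ∷ []) (sucMod-≢-predMod x ∘ ∷-injectiveˡ ∘ ∷-injectiveʳ ∘ ∷-injectiveʳ)
      (SAdj-clique x y (z≢s′ y≢s y≢p ∘ sym)) (SAdj-clique x y (z≢p ∘ sym))
      (f-sucMod x y y≢s y≢p) (f-predMod x y)

  nonShift-or-shift : ∀ x y → 𝟙 (nonShift? x y) + 𝟙 (y ≟ sucMod x) + 𝟙 (y ≟ predMod x) ≡ 1
  nonShift-or-shift x y with y ≟ sucMod x | y ≟ predMod x
  ... | yes refl | yes s≡p = contradiction s≡p (sucMod-≢-predMod x)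
  ... | yes _    | no _    = refl
  ... | no _     | yes _   = refl
  ... | no _     | no _    = refl

  ∑-nonShift : ∀ x → ∑[ y < n ] 𝟙 (nonShift? x y) ≡ suc k
  ∑-nonShift x = +-cancelʳ-≡ 2 _ (suc k) (begin
    ∑[ y < n ] 𝟙 (nonShift? x y) + 2  ≡⟨ +-assoc (∑[ y < n ] 𝟙 (nonShift? x y)) 1 1 ⟨
    ∑[ y < n ] 𝟙 (nonShift? x y) + 1 + 1
      ≡⟨ cong₂ (λ a b → ∑[ y < n ] 𝟙 (nonShift? x y) + a + b) (∑-𝟙-≟ (sucMod x)) (∑-𝟙-≟ (predMod x)) ⟨
    ∑[ y < n ] 𝟙 (nonShift? x y) + ∑[ y < n ] 𝟙 (y ≟ sucMod x) + ∑[ y < n ] 𝟙 (y ≟ predMod x)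
      ≡⟨ cong (_+ ∑[ y < n ] 𝟙 (y ≟ predMod x)) (∑-distrib-+ (λ y → 𝟙 (nonShift? x y)) (λ y → 𝟙 (y ≟ sucMod x))) ⟨
    ∑[ y < n ] (𝟙 (nonShift? x y) + 𝟙 (y ≟ sucMod x)) + ∑[ y < n ] 𝟙 (y ≟ predMod x)
      ≡⟨ ∑-distrib-+ (λ y → 𝟙 (nonShift? x y) + 𝟙 (y ≟ sucMod x)) (λ y → 𝟙 (y ≟ predMod x)) ⟨
    ∑[ y < n ] (𝟙 (nonShift? x y) + 𝟙 (y ≟ sucMod x) + 𝟙 (y ≟ predMod x))
      ≡⟨ sum-cong-≗ {n} (nonShift-or-shift x) ⟩
    ∑[ y < n ] 1                 ≡⟨ ∑-const n 1 ⟩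
    n * 1                        ≡⟨ *-identityʳ n ⟩
    2 + suc k                    ≡⟨ +-comm 2 (suc k) ⟩
    suc k + 2                    ∎)
    where open ≡-Reasoning

  cliqueWeight-f : ∀ x y → cliqueWeight f (x ∷ y ∷ []) ≡ 1 + 𝟙 (nonShift? x y)
  cliqueWeight-f x y = begin
    ∑[ z < n ] (𝟙 (z ≟ predMod x) + 𝟙 (nonShift? x y) * 𝟙 (z ≟ sucMod x))
      ≡⟨ ∑-distrib-+ (λ z → 𝟙 (z ≟ predMod x)) (λ z → 𝟙 (nonShift? x y) * 𝟙 (z ≟ sucMod x)) ⟩
    ∑[ z < n ] 𝟙 (z ≟ predMod x) + ∑[ z < n ] (𝟙 (nonShift? x y) * 𝟙 (z ≟ sucMod x))
      ≡⟨ cong₂ _+_ (∑-𝟙-≟ (predMod x)) (sym (*-distribˡ-sum (𝟙 (nonShift? x y)) (λ z → 𝟙 (z ≟ sucMod x)))) ⟩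
    1 + 𝟙 (nonShift? x y) * ∑[ z < n ] 𝟙 (z ≟ sucMod x)
      ≡⟨ cong (λ s → 1 + 𝟙 (nonShift? x y) * s) (∑-𝟙-≟ (sucMod x)) ⟩
    1 + 𝟙 (nonShift? x y) * 1       ≡⟨ cong (1 +_) (*-identityʳ (𝟙 (nonShift? x y))) ⟩
    1 + 𝟙 (nonShift? x y)           ∎
    where open ≡-Reasoning

  weight-f : weight f ≡ 2 * n * (n ∸ 1)
  weight-f = begin
    weight f                                      ≡⟨ sum-allWords f ⟩
    ∑[ x < n ] ∑[ y < n ] cliqueWeight f (x ∷ y ∷ []) ≡⟨ sum-cong-≗ {n} (λ x → sum-cong-≗ {n} (cliqueWeight-f x)) ⟩
    ∑[ x < n ] ∑[ y < n ] (1 + 𝟙 (nonShift? x y))    ≡⟨ sum-cong-≗ {n} block-weight ⟩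
    ∑[ x < n ] (n + suc k)                        ≡⟨ ∑-const n (n + suc k) ⟩
    n * (n + suc k)                               ≡⟨ count k ⟩
    2 * n * (n ∸ 1)                               ∎
    where
    open ≡-Reasoning
    block-weight : ∀ x → ∑[ y < n ] (1 + 𝟙 (nonShift? x y)) ≡ n + suc k
    block-weight x = trans (∑-distrib-+ (λ _ → 1) (λ y → 𝟙 (nonShift? x y)))
                          (cong₂ _+_ (trans (∑-const n 1) (*-identityʳ n)) (∑-nonShift x))
    count : ∀ k → (3 + k) * ((3 + k) + (1 + k)) ≡ 2 * (3 + k) * (2 + k)
    count = solve-∀

theorem3p2 : ∀ (n : ℕ) → 3 ≤ n → ItalianDominationNumber n 3 (2 * n * (n ∸ 1))
theorem3p2 (suc (suc (suc k))) (s≤s (s≤s (s≤s z≤n))) =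
  (f , (f≤2 , f-dominating) , weight-f) ,
  λ g (_ , dominated) → italian-lower-bound (3 + k) g dominated
  where open CyclicIDF k
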